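{- Let $k \geq 2$, let $q_1, \ldots, q_k$ be $k$ distinct prime numbers and $P = \prod_{i=1}^k q_i$. Let $r_1, \ldots, r_k$ be arbitrary integers (a residue class $r_i$ modulo $q_i$ for each $i$), and for $1 \le n \le P$ let $\gamma(n) = \#\{ i \in\{1,\dots,k\} : n \equiv r_i \pmod{q_i}\}$. Then, for every such choice of $r_1,\dots,r_k$, $$\#\{ n \in \{1,\dots,P\} : \gamma(n) \le 1\} = A_k(q_1,\dots,q_k) \quad\text{and}\quad \#\{ n \in \{1,\dots,P\} : \gamma(n) = 0\} = F_k(q_1,\dots,q_k),$$ where $A_k(q_1,\dots,q_k)$ is the determinant of the $k\times k$ matrix with diagonal entries $q_1,\dots,q_k$ and all off-diagonal entries equal to $1$, and $F_k(q_1,\dots,q_k) = (-1)^k \det N$, where $N$ is the $(k+1)\times(k+1)$ matrix whose first row consists entirely of ones and, for $1 \le i \le k$, whose row $i+1$ has entry $q_i$ in column $i$ and entry $1$ in every other column. -}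

module Defs where

open import Data.Nat as ℕ using (ℕ; zero; suc)
open import Data.Integer as ℤ using (ℤ; +_; -_; _-_)
open import Data.Integer.Divisibility.Signed using (_∣_; _∣?_)
open import Data.Fin using (Fin; inject₁; zero; suc; toℕ; punchIn; _≟_)
open import Relation.Nullary using (yes; no)
open import Data.List using (List; map; upTo; length; filter; allFin)
open import Data.Nat.ListAction using (product)

Matrix : ℕ → Set
Matrix n = Fin n → Fin n → ℤ

sumFin : ∀ {n} → (Fin n → ℤ) → ℤ
sumFin {zero}  f = + 0
sumFin {suc n} f = f zero ℤ.+ sumFin (λ j → f (suc j))

det : ∀ {n} → Matrix n → ℤ
det {zero}  M = + 1
det {suc n} M = sumFin λ j →
  ((- (+ 1)) ℤ.^ toℕ j) ℤ.* (M zero j ℤ.* det (λ a b → M (suc a) (punchIn j b)))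

matA : ∀ {k} → (Fin k → ℕ) → Matrix k
matA q i j with i ≟ j
... | yes _ = + q i
... | no _  = + 1

-- (k+1)×(k+1) matrix N. Paper (1-based): first row all ones; row i+1 has q_i in
-- column i, 1 elsewhere. 0-based: row 0 is all ones; row (suc i) has q i in column i (= inject₁ i), 1 elsewhere.
matN : ∀ {k} → (Fin k → ℕ) → Matrix (suc k)
matN q zero    j = + 1
matN q (suc i) j with inject₁ i ≟ j
... | yes _ = + q i
... | no _  = + 1

A : ∀ k → (Fin k → ℕ) → ℤ
A k q = det (matA q)

F : ∀ k → (Fin k → ℕ) → ℤ
F k q = ((- (+ 1)) ℤ.^ k) ℤ.* det (matN q)

γ : ∀ {k} → (Fin k → ℕ) → (Fin k → ℤ) → ℕ → ℕ
γ {k} q r n = length (filter (λ i → (+ q i) ∣? ((+ n) - r i)) (allFin k))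

prodQ : ∀ {k} → (Fin k → ℕ) → ℕ
prodQ {k} q = product (map q (allFin k))

range1 : ℕ → List ℕ
range1 P = map suc (upTo P)

-- Write dᵢ = qᵢ − 1 and m = q₂⋯q_k. Splitting n − 1 = t·m + n′ with t < q₁, γ(n) is the indicator
-- of q₁ ∣ n − r₁ plus the γ of the remaining primes at 1 + n′, which is m-periodic; since m is
-- invertible modulo q₁, exactly one t in each fibre makes the indicator 1. Hence counting the n with
-- weight w(γ(n)) over the period turns w into w(· + 1) + d₁·w, and for weights supported on {0, 1}
-- induction on k gives #{γ = 0} = ∏ dᵢ and #{γ ≤ 1} = ∏ dᵢ + e_{k−1}(d).
--
-- On the other side, matA = diag(d) + 𝟙𝟙ᵀ, and matN arises from the matrix with first row 𝟙 and
-- row i + 1 equal to dᵢ times the i-th unit vector by adding the first row to all the others. The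
-- rank-one expansion det(M + c vᵀ) = det M + Σₐ cₐ det(M with row a replaced by v), a consequence
-- of multilinearity and alternation, evaluates det matA = ∏ d + e_{k−1}(d) and det matN = (−1)ᵏ ∏ d.

module Submission where

open import Defs
open import Data.Nat as ℕ using (ℕ; zero; suc; _≤_; _<_; _∸_; _≤?_; _≟_; NonZero; s≤s; z<s)
open import Data.Integer using (ℤ; +_; -[1+_]; -_; _+_; _*_; _-_; _^_; -1ℤ; _%ℕ_; _/ℕ_)
open import Data.Integer.Properties using (+-*-semiring; *-identityˡ; *-zeroʳ; +-identityˡ; +-identityʳ; +-assoc; *-assoc; pos-*; neg-distribˡ-*)
open import Data.Integer.Tactic.RingSolver using (solve-∀)
open import Data.Fin as Fin using (Fin; zero; suc; toℕ; punchIn; punchOut; fromℕ; inject₁)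
open import Data.Fin.Properties using (toℕ<n; toℕ-fromℕ; suc-injective; 0≢1+n; punchInᵢ≢i; punchIn-injective; punchOut-punchIn; punchOut-cong)
open import Data.Vec.Functional using (Vector; _∷_; head; tail; removeAt; updateAt)
open import Data.Vec.Functional.Properties using (updateAt-updates; map-updateAt)
open import Function using (_∘_; const; id)
open import Relation.Binary.PropositionalEquality
open import Relation.Nullary using (Dec; yes; no; ¬_; does)
open import Data.Bool using (true; false; if_then_else_)
open import Relation.Nullary.Decidable using (dec-true; dec-false)
open import Data.Empty using (⊥-elim)
open import Data.Product using (_,_; _×_; ∃-syntax)
open import Data.Sum using (_⊎_; inj₁; inj₂)
open import Data.Nat.Divisibility using (>⇒∤; ∣1⇒≡1) renaming (_∣_ to _∣ₙ_)
import Data.Nat.Properties as ℕₚ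
open ℕₚ using (m+[n∸m]≡n; m∸n≤m)
open import Data.Nat.Primality using (Prime; prime⇒irreducible; prime⇒nonZero; euclidsLemma; ¬prime[1])
open import Data.Integer.DivMod using (a≡a%ℕn+[a/ℕn]*n; n%ℕd<d)
open import Data.Nat.Coprimality using (Coprime; coprime-Bézout)
open import Data.Nat.GCD using (module Bézout)
open import Data.Integer.Divisibility.Signed using (_∣_; _∣?_; divides; ∣⇒∣ᵤ; ∣ᵤ⇒∣; ∣m∣n⇒∣m-n; ∣m∣n⇒∣m+n; ∣m+n∣n⇒∣m; ∣n⇒∣m*n)
open import Data.List as L using (length; filter; tabulate; allFin; applyUpTo)
open import Data.List.Properties using (filter-≐; map-tabulate; map-applyUpTo)
open import Data.Nat.ListAction using (product)
open import Data.List.Relation.Unary.All using (All)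
import Data.List.Relation.Unary.All as All
import Data.List.Relation.Unary.All.Properties as All
open import Data.List.Membership.Propositional.Properties using (∈-map⁺; ∈-allFin)
open import Data.Nat.ListAction.Properties using (∈⇒∣product)
open import Function.Definitions using (Injective)

open import Algebra.Properties.Semiring.Sum +-*-semiring
  using (sum; sum-cong-≗; sum-replicate-zero; sum-remove; ∑-distrib-+; ∑-comm; *-distribˡ-sum)

-- Finite sums

sumFin≡sum : ∀ {n} (f : Fin n → ℤ) → sumFin f ≡ sum f
sumFin≡sum {zero}  f = refl
sumFin≡sum {suc n} f = cong (_+_ (f zero)) (sumFin≡sum (f ∘ suc))

sum-zeros : ∀ {n} {f : Fin n → ℤ} → (∀ j → f j ≡ + 0) → sum f ≡ + 0
sum-zeros {n} f≗0 = trans (sum-cong-≗ f≗0) (sum-replicate-zero n)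

*-distribˡ-sum₂ : ∀ {n} (s u : ℤ) (f : Fin n → ℤ) → s * (u * sum f) ≡ sum (λ a → s * (u * f a))
*-distribˡ-sum₂ s u f = trans (cong (s *_) (*-distribˡ-sum u f)) (*-distribˡ-sum s (λ a → u * f a))

sum-distrib-∑-comm : ∀ {m k} (s u D : Fin m → ℤ) (c : Fin k → ℤ) (E : Fin k → Fin m → ℤ) →
  sum (λ j → s j * (u j * (D j + sum (λ a → c a * E a j))))
    ≡ sum (λ j → s j * (u j * D j)) + sum (λ a → c a * sum (λ j → s j * (u j * E a j)))
sum-distrib-∑-comm s u D c E = begin
  sum (λ j → s j * (u j * (D j + sum (λ a → c a * E a j))))
    ≡⟨ sum-cong-≗ (λ j → trans (distrib (s j) (u j) (D j) _) (cong (_+_ (s j * (u j * D j)))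
         (*-distribˡ-sum₂ (s j) (u j) (λ a → c a * E a j)))) ⟩
  sum (λ j → s j * (u j * D j) + sum (λ a → s j * (u j * (c a * E a j))))
    ≡⟨ ∑-distrib-+ (λ j → s j * (u j * D j)) (λ j → sum (λ a → s j * (u j * (c a * E a j)))) ⟩
  sum (λ j → s j * (u j * D j)) + sum (λ j → sum (λ a → s j * (u j * (c a * E a j))))
    ≡⟨ cong (_+_ (sum (λ j → s j * (u j * D j)))) (trans (∑-comm (λ j a → s j * (u j * (c a * E a j))))
         (sum-cong-≗ λ a → trans (sum-cong-≗ λ j → commute (s j) (u j) (c a) (E a j))
                                 (sym (*-distribˡ-sum (c a) (λ j → s j * (u j * E a j)))))) ⟩
  sum (λ j → s j * (u j * D j)) + sum (λ a → c a * sum (λ j → s j * (u j * E a j))) ∎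
  where
  open ≡-Reasoning
  distrib : ∀ s u D S → s * (u * (D + S)) ≡ s * (u * D) + s * (u * S)
  distrib = solve-∀
  commute : ∀ s u c e → s * (u * (c * e)) ≡ c * (s * (u * e))
  commute = solve-∀

-- Determinants

sign : ∀ {n} → Fin n → ℤ
sign j = -1ℤ ^ toℕ j

removeColumn : ∀ {m n} → (Fin m → Vector ℤ (suc n)) → Fin (suc n) → Fin m → Vector ℤ n
removeColumn R j a = removeAt (R a) j

det-laplace : ∀ {n} (u : Vector ℤ (suc n)) (R : Fin n → Vector ℤ (suc n)) →
  det (u ∷ R) ≡ sum (λ j → sign j * (u j * det (removeColumn R j)))
det-laplace u R = sumFin≡sum (λ j → sign j * (u j * det (removeColumn R j)))

det-cong : ∀ {n} {M N : Matrix n} → (∀ a b → M a b ≡ N a b) → det M ≡ det N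
det-cong {zero}          _   = refl
det-cong {suc n} {M} {N} M≗N = begin
  det M                                                            ≡⟨ det-laplace (head M) (tail M) ⟩
  sum (λ j → sign j * (M zero j * det (removeColumn (tail M) j)))  ≡⟨ sum-cong-≗ entries≗ ⟩
  sum (λ j → sign j * (N zero j * det (removeColumn (tail N) j)))  ≡⟨ det-laplace (head N) (tail N) ⟨
  det N                                                            ∎
  where
  open ≡-Reasoning
  entries≗ : ∀ j → sign j * (M zero j * det (removeColumn (tail M) j))
                 ≡ sign j * (N zero j * det (removeColumn (tail N) j))
  entries≗ j = cong₂ (λ x y → sign j * (x * y)) (M≗N zero j) (det-cong λ a b → M≗N (suc a) (punchIn j b))

det-zeroRow : ∀ {n} (M : Matrix n) (a : Fin n) → (∀ b → M a b ≡ + 0) → det M ≡ + 0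
det-zeroRow {suc n} M zero    row≗0 = trans (det-laplace (head M) (tail M)) (sum-zeros λ j →
  trans (cong (λ x → sign j * (x * det (removeColumn (tail M) j))) (row≗0 j)) (*-zeroʳ (sign j)))
det-zeroRow {suc n} M (suc a) row≗0 = trans (det-laplace (head M) (tail M)) (sum-zeros λ j →
  trans (cong (λ x → sign j * (M zero j * x)) (det-zeroRow (removeColumn (tail M) j) a (row≗0 ∘ punchIn j)))
        (trans (cong (sign j *_) (*-zeroʳ (M zero j))) (*-zeroʳ (sign j))))

det-row₀-supported : ∀ {n} (u : Vector ℤ (suc n)) (R : Fin n → Vector ℤ (suc n)) (x : Fin (suc n)) →
  (∀ l → u (punchIn x l) ≡ + 0) → det (u ∷ R) ≡ sign x * (u x * det (removeColumn R x))
det-row₀-supported u R x u≗0 = begin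
  det (u ∷ R)                         ≡⟨ det-laplace u R ⟩
  sum term                            ≡⟨ sum-remove {i = x} term ⟩
  term x + sum (term ∘ punchIn x)     ≡⟨ cong (_+_ (term x)) (sum-zeros offSupport) ⟩
  term x + + 0                        ≡⟨ +-identityʳ (term x) ⟩
  term x                              ∎
  where
  open ≡-Reasoning
  term : Fin (suc _) → ℤ
  term j = sign j * (u j * det (removeColumn R j))
  offSupport : ∀ l → term (punchIn x l) ≡ + 0
  offSupport l = trans (cong (λ y → sign (punchIn x l) * (y * det (removeColumn R (punchIn x l)))) (u≗0 l))
                       (*-zeroʳ (sign (punchIn x l)))

diagonal : ∀ {n} → (Fin n → ℤ) → Matrix n
diagonal d i j = if does (i Fin.≟ j) then d i else + 0

∏ : ∀ {n} → (Fin n → ℤ) → ℤ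
∏ {zero}  d = + 1
∏ {suc n} d = d zero * ∏ (d ∘ suc)

det-diagonal : ∀ {n} (d : Fin n → ℤ) → det (diagonal d) ≡ ∏ d
det-diagonal {zero}  d = refl
det-diagonal {suc n} d = begin
  det (diagonal d)
    ≡⟨ det-row₀-supported (head (diagonal d)) (tail (diagonal d)) zero (λ _ → refl) ⟩
  + 1 * (d zero * det (diagonal (d ∘ suc)))
    ≡⟨ *-identityˡ _ ⟩
  d zero * det (diagonal (d ∘ suc))
    ≡⟨ cong (d zero *_) (det-diagonal (d ∘ suc)) ⟩
  d zero * ∏ (d ∘ suc) ∎
  where open ≡-Reasoning

punchIn-punchIn-comm : ∀ {n} {x y : Fin (suc (suc n))} (x≢y : x ≢ y) (y≢x : y ≢ x) (b : Fin n) →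
  punchIn x (punchIn (punchOut x≢y) b) ≡ punchIn y (punchIn (punchOut y≢x) b)
punchIn-punchIn-comm {x = zero}  {zero}  x≢y _ b = ⊥-elim (x≢y refl)
punchIn-punchIn-comm {x = zero}  {suc y} _   _ b = refl
punchIn-punchIn-comm {x = suc x} {zero}  _   _ b = refl
punchIn-punchIn-comm {x = suc x} {suc y} _   _ zero = refl
punchIn-punchIn-comm {suc n} {suc x} {suc y} x≢y y≢x (suc b) =
  cong suc (punchIn-punchIn-comm (x≢y ∘ cong suc) (y≢x ∘ cong suc) b)

sign-punchOut-antisym : ∀ {n} {x y : Fin (suc n)} (x≢y : x ≢ y) (y≢x : y ≢ x) →
  sign x * sign (punchOut x≢y) ≡ - (sign y * sign (punchOut y≢x))
sign-punchOut-antisym {x = zero}  {zero}  x≢y _ = ⊥-elim (x≢y refl)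
sign-punchOut-antisym {suc n} {zero}  {suc y} _ _ = flip (sign y)
  where
  flip : ∀ s → + 1 * s ≡ - ((-1ℤ * s) * + 1)
  flip = solve-∀
sign-punchOut-antisym {suc n} {suc x} {zero}  _ _ = flip (sign x)
  where
  flip : ∀ s → (-1ℤ * s) * + 1 ≡ - (+ 1 * s)
  flip = solve-∀
sign-punchOut-antisym {suc n} {suc x} {suc y} x≢y y≢x =
  shift (sign x) _ (sign y) _ (sign-punchOut-antisym (x≢y ∘ cong suc) (y≢x ∘ cong suc))
  where
  shift : ∀ a b c d → a * b ≡ - (c * d) → (-1ℤ * a) * (-1ℤ * b) ≡ - ((-1ℤ * c) * (-1ℤ * d))
  shift a b c d ab≡-cd = trans (ring₁ a b) (trans ab≡-cd (ring₂ c d))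
    where
    ring₁ : ∀ a b → (-1ℤ * a) * (-1ℤ * b) ≡ a * b
    ring₁ = solve-∀
    ring₂ : ∀ c d → - (c * d) ≡ - ((-1ℤ * c) * (-1ℤ * d))
    ring₂ = solve-∀

module _ {n} (R : Fin n → Vector ℤ (suc (suc n))) where

  pairTerm : (u w : Vector ℤ (suc (suc n))) → Fin (suc (suc n)) → Fin (suc (suc n)) → ℤ
  pairTerm u w x y with x Fin.≟ y
  ... | yes _  = + 0
  ... | no x≢y = sign x * sign (punchOut x≢y) *
                 (u x * (w y * det (removeColumn (removeColumn R x) (punchOut x≢y))))

  pairTerm-diagonal : ∀ u w x → pairTerm u w x x ≡ + 0
  pairTerm-diagonal u w x with x Fin.≟ x
  ... | yes _  = refl
  ... | no x≢x = ⊥-elim (x≢x refl)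

  pairTerm-punchIn : ∀ u w x l → pairTerm u w x (punchIn x l) ≡
    sign x * sign l * (u x * (w (punchIn x l) * det (removeColumn (removeColumn R x) l)))
  pairTerm-punchIn u w x l with x Fin.≟ punchIn x l
  ... | yes x≡x+l = ⊥-elim (punchInᵢ≢i x l (sym x≡x+l))
  ... | no x≢x+l  = cong (λ l′ → sign x * sign l′ *
                           (u x * (w (punchIn x l) * det (removeColumn (removeColumn R x) l′))))
                         (trans (punchOut-cong x refl) (punchOut-punchIn x))

  pairTerm-antisym : ∀ u w x y → pairTerm u w x y + pairTerm w u y x ≡ + 0
  pairTerm-antisym u w x y with x Fin.≟ y | y Fin.≟ x
  ... | yes _   | yes _   = refl
  ... | yes x≡y | no y≢x  = ⊥-elim (y≢x (sym x≡y))
  ... | no x≢y  | yes y≡x = ⊥-elim (x≢y (sym y≡x))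
  ... | no x≢y  | no y≢x  = begin
    sx * (u x * (w y * D x≢y)) + sy * (w y * (u x * D y≢x))
      ≡⟨ cong (λ D′ → sx * (u x * (w y * D x≢y)) + sy * (w y * (u x * D′)))
              (det-cong λ a b → cong (R a) (sym (punchIn-punchIn-comm x≢y y≢x b))) ⟩
    sx * (u x * (w y * D x≢y)) + sy * (w y * (u x * D x≢y))
      ≡⟨ cong (λ s → sx * (u x * (w y * D x≢y)) + s * (w y * (u x * D x≢y)))
              (sign-punchOut-antisym y≢x x≢y) ⟩
    sx * (u x * (w y * D x≢y)) + - sx * (w y * (u x * D x≢y))
      ≡⟨ cancel sx (u x) (w y) (D x≢y) ⟩
    + 0 ∎
    where
    open ≡-Reasoning
    sx = sign x * sign (punchOut x≢y)
    sy = sign y * sign (punchOut y≢x)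
    D : ∀ {x y} → x ≢ y → ℤ
    D {x} x≢y = det (removeColumn (removeColumn R x) (punchOut x≢y))
    cancel : ∀ s a b c → s * (a * (b * c)) + - s * (b * (a * c)) ≡ + 0
    cancel = solve-∀

  det-pairExpansion : ∀ u w → det (u ∷ w ∷ R) ≡ sum (λ x → sum (pairTerm u w x))
  det-pairExpansion u w = trans (det-laplace u (w ∷ R)) (sum-cong-≗ expandRow)
    where
    open ≡-Reasoning
    expandRow : ∀ x → sign x * (u x * det (removeColumn (w ∷ R) x)) ≡ sum (pairTerm u w x)
    expandRow x = begin
      sign x * (u x * det (removeColumn (w ∷ R) x))
        ≡⟨ cong (λ D → sign x * (u x * D)) (det-laplace (removeAt w x) (removeColumn R x)) ⟩
      sign x * (u x * sum term)
        ≡⟨ *-distribˡ-sum₂ (sign x) (u x) term ⟩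
      sum (λ l → sign x * (u x * term l))
        ≡⟨ sum-cong-≗ (λ l → trans (regroup (sign x) (u x) (sign l) (w (punchIn x l)) (D l))
                                   (sym (pairTerm-punchIn u w x l))) ⟩
      sum (pairTerm u w x ∘ punchIn x)
        ≡⟨ +-identityˡ _ ⟨
      + 0 + sum (pairTerm u w x ∘ punchIn x)
        ≡⟨ cong (_+ sum (pairTerm u w x ∘ punchIn x)) (pairTerm-diagonal u w x) ⟨
      pairTerm u w x x + sum (pairTerm u w x ∘ punchIn x)
        ≡⟨ sum-remove {i = x} (pairTerm u w x) ⟨
      sum (pairTerm u w x) ∎
      where
      D : Fin (suc n) → ℤ
      D l = det (removeColumn (removeColumn R x) l)
      term : Fin (suc n) → ℤ
      term l = sign l * (w (punchIn x l) * D l)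
      regroup : ∀ s a t b D → s * (a * (t * (b * D))) ≡ s * t * (a * (b * D))
      regroup = solve-∀

  det-swap₀₁ : ∀ u w → det (u ∷ w ∷ R) + det (w ∷ u ∷ R) ≡ + 0
  det-swap₀₁ u w = begin
    det (u ∷ w ∷ R) + det (w ∷ u ∷ R)
      ≡⟨ cong₂ _+_ (det-pairExpansion u w) (trans (det-pairExpansion w u) (∑-comm (pairTerm w u))) ⟩
    sum (λ x → sum (pairTerm u w x)) + sum (λ x → sum (λ y → pairTerm w u y x))
      ≡⟨ ∑-distrib-+ (λ x → sum (pairTerm u w x)) (λ x → sum (λ y → pairTerm w u y x)) ⟨
    sum (λ x → sum (pairTerm u w x) + sum (λ y → pairTerm w u y x))
      ≡⟨ sum-cong-≗ (λ x → sym (∑-distrib-+ (pairTerm u w x) (λ y → pairTerm w u y x))) ⟩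
    sum (λ x → sum (λ y → pairTerm u w x y + pairTerm w u y x))
      ≡⟨ sum-zeros (λ x → sum-zeros (pairTerm-antisym u w x)) ⟩
    + 0 ∎
    where open ≡-Reasoning

i+i≡0⇒i≡0 : ∀ {i} → i + i ≡ + 0 → i ≡ + 0
i+i≡0⇒i≡0 {+ zero}   _  = refl
i+i≡0⇒i≡0 {+ suc _}  ()
i+i≡0⇒i≡0 { -[1+ _ ] } ()

det-unfoldRow₁ : ∀ {n} (u : Vector ℤ (suc (suc n))) (R : Fin (suc n) → Vector ℤ (suc (suc n))) →
  det (u ∷ R) ≡ det (u ∷ R zero ∷ tail R)
det-unfoldRow₁ u R = det-cong {M = u ∷ R} {N = u ∷ R zero ∷ tail R} λ where
  zero          _ → refl
  (suc zero)    _ → refl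
  (suc (suc _)) _ → refl

-- Swapping rows 0 and 1 negates the determinant. If row 1 repeats row 0 this forces it to vanish;
-- otherwise, after the swap, both copies lie below row 0 and every Laplace minor inherits them.
det-repeatedRow₀ : ∀ {n} (u : Vector ℤ (suc n)) (R : Fin n → Vector ℤ (suc n)) (b : Fin n) →
  (∀ j → R b j ≡ u j) → det (u ∷ R) ≡ + 0
det-repeatedRow₀ u R zero R₀≗u = i+i≡0⇒i≡0 (begin
  det (u ∷ R) + det (u ∷ R)
    ≡⟨ cong₂ _+_ (det-unfoldRow₁ u R) (det-cong swapRows) ⟩
  det (u ∷ R zero ∷ tail R) + det (R zero ∷ u ∷ tail R)
    ≡⟨ det-swap₀₁ (tail R) u (R zero) ⟩
  + 0 ∎)
  where
  open ≡-Reasoning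
  swapRows : ∀ a j → (u ∷ R) a j ≡ (R zero ∷ u ∷ tail R) a j
  swapRows zero          j = sym (R₀≗u j)
  swapRows (suc zero)    j = R₀≗u j
  swapRows (suc (suc a)) j = refl
det-repeatedRow₀ u R (suc b) R₁₊b≗u = begin
  det (u ∷ R)
    ≡⟨ det-unfoldRow₁ u R ⟩
  det (u ∷ R zero ∷ tail R)
    ≡⟨ +-identityʳ _ ⟨
  det (u ∷ R zero ∷ tail R) + + 0
    ≡⟨ cong (_+_ (det (u ∷ R zero ∷ tail R))) swappedVanishes ⟨
  det (u ∷ R zero ∷ tail R) + det (R zero ∷ u ∷ tail R)
    ≡⟨ det-swap₀₁ (tail R) u (R zero) ⟩
  + 0 ∎
  where
  open ≡-Reasoning
  swappedVanishes : det (R zero ∷ u ∷ tail R) ≡ + 0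
  swappedVanishes = trans (det-laplace (R zero) (u ∷ tail R)) (sum-zeros λ j →
    trans (cong (λ D → sign j * (R zero j * D))
                (det-repeatedRow₀ (removeAt u j) (removeColumn (tail R) j) b (R₁₊b≗u ∘ punchIn j)))
          (trans (cong (sign j *_) (*-zeroʳ (R zero j))) (*-zeroʳ (sign j))))

det-linear₀ : ∀ {n} (u w : Vector ℤ (suc n)) (s : ℤ) (R : Fin n → Vector ℤ (suc n)) →
  det ((λ j → u j + s * w j) ∷ R) ≡ det (u ∷ R) + s * det (w ∷ R)
det-linear₀ u w s R = begin
  det ((λ j → u j + s * w j) ∷ R)
    ≡⟨ det-laplace (λ j → u j + s * w j) R ⟩
  sum (λ j → sign j * ((u j + s * w j) * D j))
    ≡⟨ sum-cong-≗ (λ j → distrib (sign j) (u j) s (w j) (D j)) ⟩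
  sum (λ j → sign j * (u j * D j) + s * (sign j * (w j * D j)))
    ≡⟨ ∑-distrib-+ (λ j → sign j * (u j * D j)) (λ j → s * (sign j * (w j * D j))) ⟩
  sum (λ j → sign j * (u j * D j)) + sum (λ j → s * (sign j * (w j * D j)))
    ≡⟨ cong₂ _+_ (det-laplace u R)
                 (trans (cong (s *_) (det-laplace w R)) (*-distribˡ-sum s (λ j → sign j * (w j * D j)))) ⟨
  det (u ∷ R) + s * det (w ∷ R) ∎
  where
  open ≡-Reasoning
  D : Fin _ → ℤ
  D j = det (removeColumn R j)
  distrib : ∀ σ a s b d → σ * ((a + s * b) * d) ≡ σ * (a * d) + s * (σ * (b * d))
  distrib = solve-∀

removeColumn-updateAt : ∀ {m n} (R : Fin m → Vector ℤ (suc n)) (a : Fin m) (v : Vector ℤ (suc n)) (j : Fin (suc n)) →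
  ∀ b c → updateAt (removeColumn R j) a (const (removeAt v j)) b c ≡ removeColumn (updateAt R a (const v)) j b c
removeColumn-updateAt R a v j b c =
  cong (λ row → row c) (sym (map-updateAt {f = λ row → removeAt row j} (λ _ → refl) R a b))

-- Expand along row 0 and use induction on the minors; the terms in which v occurs both in row 0 and
-- in a lower row vanish by det-repeatedRow₀.
det-rankOne : ∀ {n} (M : Matrix n) (c v : Vector ℤ n) →
  det (λ a b → M a b + c a * v b) ≡ det M + sum (λ a → c a * det (updateAt M a (const v)))
det-rankOne {zero}  M c v = refl
det-rankOne {suc n} M c v = begin
  det (λ a b → M a b + c a * v b)
    ≡⟨ det-laplace u (λ a b → M (suc a) b + c (suc a) * v b) ⟩
  sum (λ j → sign j * (u j * det (λ a b → removeColumn (tail M) j a b + c (suc a) * removeAt v j b)))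
    ≡⟨ sum-cong-≗ (λ j → cong (λ D → sign j * (u j * D)) (minor-rankOne j)) ⟩
  sum (λ j → sign j * (u j * (det (removeColumn (tail M) j) + sum (λ a → c (suc a) * E a j))))
    ≡⟨ sum-distrib-∑-comm sign u (λ j → det (removeColumn (tail M) j)) (tail c) E ⟩
  sum (λ j → sign j * (u j * det (removeColumn (tail M) j)))
    + sum (λ a → c (suc a) * sum (λ j → sign j * (u j * E a j)))
    ≡⟨ cong₂ _+_ (det-laplace u (tail M)) (sum-cong-≗ λ a → cong (c (suc a) *_) (det-laplace u (Mᵥ a))) ⟨
  det (u ∷ tail M) + sum (λ a → c (suc a) * det (u ∷ Mᵥ a))
    ≡⟨ cong₂ _+_ (det-linear₀ (M zero) v (c zero) (tail M)) (sum-cong-≗ λ a → cong (c (suc a) *_)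
         (trans (det-linear₀ (M zero) v (c zero) (Mᵥ a)) (repeated a))) ⟩
  (det M + c zero * det (v ∷ tail M)) + sum (λ a → c (suc a) * det (M zero ∷ Mᵥ a))
    ≡⟨ +-assoc (det M) _ _ ⟩
  det M + sum (λ a → c a * det (updateAt M a (const v))) ∎
  where
  open ≡-Reasoning
  u : Vector ℤ (suc n)
  u j = M zero j + c zero * v j
  Mᵥ : Fin n → Fin n → Vector ℤ (suc n)
  Mᵥ a = updateAt (tail M) a (const v)
  E : Fin n → Fin (suc n) → ℤ
  E a j = det (removeColumn (Mᵥ a) j)
  minor-rankOne : ∀ j → det (λ a b → removeColumn (tail M) j a b + c (suc a) * removeAt v j b)
                      ≡ det (removeColumn (tail M) j) + sum (λ a → c (suc a) * E a j)
  minor-rankOne j = trans (det-rankOne (removeColumn (tail M) j) (tail c) (removeAt v j))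
    (cong (_+_ (det (removeColumn (tail M) j)))
          (sum-cong-≗ λ a → cong (c (suc a) *_) (det-cong (removeColumn-updateAt (tail M) a v j))))
  repeated : ∀ a → det (M zero ∷ Mᵥ a) + c zero * det (v ∷ Mᵥ a) ≡ det (M zero ∷ Mᵥ a)
  repeated a = begin
    det (M zero ∷ Mᵥ a) + c zero * det (v ∷ Mᵥ a)
      ≡⟨ cong (λ D → det (M zero ∷ Mᵥ a) + c zero * D)
              (det-repeatedRow₀ v (Mᵥ a) a (λ j → cong (λ row → row j) (updateAt-updates a (tail M)))) ⟩
    det (M zero ∷ Mᵥ a) + c zero * + 0
      ≡⟨ cong (_+_ (det (M zero ∷ Mᵥ a))) (*-zeroʳ (c zero)) ⟩
    det (M zero ∷ Mᵥ a) + + 0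
      ≡⟨ +-identityʳ (det (M zero ∷ Mᵥ a)) ⟩
    det (M zero ∷ Mᵥ a) ∎

-- The matrices matA and matN

diagonalAvoiding : ∀ {n} → Fin (suc n) → (Fin n → ℤ) → Fin n → Vector ℤ (suc n)
diagonalAvoiding x d i j = if does (punchIn x i Fin.≟ j) then d i else + 0

does-punchIn-≟ : ∀ {n} (x : Fin (suc n)) (a b : Fin n) → does (punchIn x a Fin.≟ punchIn x b) ≡ does (a Fin.≟ b)
does-punchIn-≟ x a b with a Fin.≟ b
... | yes refl = dec-true (punchIn x a Fin.≟ punchIn x a) refl
... | no a≢b   = dec-false (punchIn x a Fin.≟ punchIn x b) (a≢b ∘ punchIn-injective x a b)

det-∷diagonalAvoiding : ∀ {n} (u : Vector ℤ (suc n)) (x : Fin (suc n)) (d : Fin n → ℤ) →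
  det (u ∷ diagonalAvoiding x d) ≡ sign x * (u x * ∏ d)
det-∷diagonalAvoiding u x d = begin
  det (u ∷ R)                      ≡⟨ det-laplace u R ⟩
  sum term                         ≡⟨ sum-remove {i = x} term ⟩
  term x + sum (term ∘ punchIn x)  ≡⟨ cong₂ _+_ (cong (λ D → sign x * (u x * D)) minor≡∏) (sum-zeros otherMinors) ⟩
  sign x * (u x * ∏ d) + + 0       ≡⟨ +-identityʳ _ ⟩
  sign x * (u x * ∏ d)             ∎
  where
  open ≡-Reasoning
  R = diagonalAvoiding x d
  term : Fin (suc _) → ℤ
  term j = sign j * (u j * det (removeColumn R j))
  minor≡∏ : det (removeColumn R x) ≡ ∏ d
  minor≡∏ = trans (det-cong λ a b → cong (λ t → if t then d a else + 0) (does-punchIn-≟ x a b)) (det-diagonal d)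
  otherMinors : ∀ l → term (punchIn x l) ≡ + 0
  otherMinors l = trans (cong (λ D → sign (punchIn x l) * (u (punchIn x l) * D))
                              (det-zeroRow (removeColumn R (punchIn x l)) l λ b →
                                 cong (λ t → if t then d l else + 0)
                                      (dec-false (punchIn x l Fin.≟ _) (punchInᵢ≢i (punchIn x l) b ∘ sym))))
                        (trans (cong (sign (punchIn x l) *_) (*-zeroʳ (u (punchIn x l)))) (*-zeroʳ (sign (punchIn x l))))

eₙ₋₁ : ∀ {n} → (Fin n → ℤ) → ℤ
eₙ₋₁ {zero}  d = + 0
eₙ₋₁ {suc n} d = ∏ (d ∘ suc) + d zero * eₙ₋₁ (d ∘ suc)

ones : ∀ {n} → Vector ℤ n
ones _ = + 1

sum-det-diagonal-onesRow : ∀ {n} (d : Fin n → ℤ) →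
  sum (λ a → det (updateAt (diagonal d) a (const ones))) ≡ eₙ₋₁ d
sum-det-diagonal-onesRow {zero}  d = refl
sum-det-diagonal-onesRow {suc n} d = cong₂ _+_ firstRow laterRows
  where
  open ≡-Reasoning
  firstRow : det (ones ∷ diagonalAvoiding zero (d ∘ suc)) ≡ ∏ (d ∘ suc)
  firstRow = trans (det-∷diagonalAvoiding ones zero (d ∘ suc)) (trans (*-identityˡ _) (*-identityˡ _))
  expandRow₀ : ∀ a → det (updateAt (diagonal d) (suc a) (const ones))
                   ≡ d zero * det (updateAt (diagonal (d ∘ suc)) a (const ones))
  expandRow₀ a = begin
    det (updateAt (diagonal d) (suc a) (const ones))
      ≡⟨ det-row₀-supported (d zero ∷ λ _ → + 0) (updateAt (tail (diagonal d)) a (const ones)) zero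
                            (λ _ → refl) ⟩
    + 1 * (d zero * det (removeColumn (updateAt (tail (diagonal d)) a (const ones)) zero))
      ≡⟨ *-identityˡ _ ⟩
    d zero * det (removeColumn (updateAt (tail (diagonal d)) a (const ones)) zero)
      ≡⟨ cong (d zero *_) (det-cong (λ b c → removeColumn-updateAt (tail (diagonal d)) a ones zero b c)) ⟨
    d zero * det (updateAt (diagonal (d ∘ suc)) a (const ones)) ∎
  laterRows : sum (λ a → det (updateAt (diagonal d) (suc a) (const ones))) ≡ d zero * eₙ₋₁ (d ∘ suc)
  laterRows = begin
    sum (λ a → det (updateAt (diagonal d) (suc a) (const ones)))
      ≡⟨ sum-cong-≗ expandRow₀ ⟩
    sum (λ a → d zero * det (updateAt (diagonal (d ∘ suc)) a (const ones)))
      ≡⟨ *-distribˡ-sum (d zero) (λ a → det (updateAt (diagonal (d ∘ suc)) a (const ones))) ⟨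
    d zero * sum (λ a → det (updateAt (diagonal (d ∘ suc)) a (const ones)))
      ≡⟨ cong (d zero *_) (sum-det-diagonal-onesRow (d ∘ suc)) ⟩
    d zero * eₙ₋₁ (d ∘ suc) ∎

x≡x-1+1*1 : ∀ x → x ≡ (x - + 1) + + 1 * + 1
x≡x-1+1*1 = solve-∀

pred : ∀ {k} → (Fin k → ℕ) → Fin k → ℤ
pred q i = + q i - + 1

matA≡diagonal+ones : ∀ {k} (q : Fin k → ℕ) a b → matA q a b ≡ diagonal (pred q) a b + + 1 * + 1
matA≡diagonal+ones q a b with a Fin.≟ b
... | yes refl = x≡x-1+1*1 (+ q a)
... | no a≢b   = refl

A≡∏+eₙ₋₁ : ∀ {k} (q : Fin k → ℕ) → A k q ≡ ∏ (pred q) + eₙ₋₁ (pred q)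
A≡∏+eₙ₋₁ q = begin
  det (matA q)
    ≡⟨ det-cong (matA≡diagonal+ones q) ⟩
  det (λ a b → diagonal (pred q) a b + ones a * ones b)
    ≡⟨ det-rankOne (diagonal (pred q)) ones ones ⟩
  det (diagonal (pred q)) + sum (λ a → + 1 * det (updateAt (diagonal (pred q)) a (const ones)))
    ≡⟨ cong₂ _+_ (det-diagonal (pred q))
         (trans (sum-cong-≗ (λ a → *-identityˡ (det (updateAt (diagonal (pred q)) a (const ones)))))
                (sum-det-diagonal-onesRow (pred q))) ⟩
  ∏ (pred q) + eₙ₋₁ (pred q) ∎
  where open ≡-Reasoning

punchIn-fromℕ : ∀ {n} (i : Fin n) → punchIn (fromℕ n) i ≡ inject₁ i
punchIn-fromℕ zero    = refl
punchIn-fromℕ (suc i) = cong suc (punchIn-fromℕ i)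

matN-suc : ∀ {k} (q : Fin k → ℕ) i b → matN q (suc i) b ≡ (if does (inject₁ i Fin.≟ b) then pred q i else + 0) + + 1 * + 1
matN-suc q i b with inject₁ i Fin.≟ b
... | yes refl = x≡x-1+1*1 (+ q i)
... | no _     = refl

matN≡rankOne : ∀ {k} (q : Fin k → ℕ) a b →
  matN q a b ≡ (ones ∷ diagonalAvoiding (fromℕ k) (pred q)) a b + (+ 0 ∷ ones) a * ones b
matN≡rankOne q zero    b = refl
matN≡rankOne q (suc i) b = trans (matN-suc q i b)
  (cong (λ c → (if does (c Fin.≟ b) then pred q i else + 0) + + 1 * + 1) (sym (punchIn-fromℕ i)))

det-matN : ∀ {k} (q : Fin k → ℕ) → det (matN q) ≡ sign (fromℕ k) * ∏ (pred q)
det-matN {k} q = begin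
  det (matN q)
    ≡⟨ det-cong (matN≡rankOne q) ⟩
  det (λ a b → N a b + (+ 0 ∷ ones) a * ones b)
    ≡⟨ det-rankOne N (+ 0 ∷ ones) ones ⟩
  det N + sum (λ a → (+ 0 ∷ ones) a * det (updateAt N a (const ones)))
    ≡⟨ cong (_+_ (det N)) (sum-zeros repeatedOnes) ⟩
  det N + + 0
    ≡⟨ +-identityʳ (det N) ⟩
  det N
    ≡⟨ det-∷diagonalAvoiding ones (fromℕ k) (pred q) ⟩
  sign (fromℕ k) * (+ 1 * ∏ (pred q))
    ≡⟨ cong (sign (fromℕ k) *_) (*-identityˡ _) ⟩
  sign (fromℕ k) * ∏ (pred q) ∎
  where
  open ≡-Reasoning
  N : Matrix (suc k)
  N = ones ∷ diagonalAvoiding (fromℕ k) (pred q)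
  repeatedOnes : ∀ a → (+ 0 ∷ ones) a * det (updateAt N a (const ones)) ≡ + 0
  repeatedOnes zero    = refl
  repeatedOnes (suc i) = trans (*-identityˡ _) (det-repeatedRow₀ ones (updateAt (tail N) i (const ones)) i
                                 (λ j → cong (λ row → row j) (updateAt-updates i (tail N))))

-1^n*-1^n≡1 : ∀ n → -1ℤ ^ n * -1ℤ ^ n ≡ + 1
-1^n*-1^n≡1 zero    = refl
-1^n*-1^n≡1 (suc n) = trans (square (-1ℤ ^ n)) (-1^n*-1^n≡1 n)
  where
  square : ∀ s → (-1ℤ * s) * (-1ℤ * s) ≡ s * s
  square = solve-∀

F≡∏ : ∀ k (q : Fin k → ℕ) → F k q ≡ ∏ (pred q)
F≡∏ k q = begin
  -1ℤ ^ k * det (matN q)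
    ≡⟨ cong (-1ℤ ^ k *_) (det-matN q) ⟩
  -1ℤ ^ k * (sign (fromℕ k) * ∏ (pred q))
    ≡⟨ cong (λ n → -1ℤ ^ k * (-1ℤ ^ n * ∏ (pred q))) (toℕ-fromℕ k) ⟩
  -1ℤ ^ k * (-1ℤ ^ k * ∏ (pred q))
    ≡⟨ *-assoc (-1ℤ ^ k) (-1ℤ ^ k) (∏ (pred q)) ⟨
  -1ℤ ^ k * -1ℤ ^ k * ∏ (pred q)
    ≡⟨ cong (_* ∏ (pred q)) (-1^n*-1^n≡1 k) ⟩
  + 1 * ∏ (pred q)
    ≡⟨ *-identityˡ (∏ (pred q)) ⟩
  ∏ (pred q) ∎
  where open ≡-Reasoning

-- Residues modulo a prime

prime∤⇒coprime : ∀ {p m} → Prime p → ¬ p ∣ₙ m → Coprime p m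
prime∤⇒coprime prime-p p∤m (d∣p , d∣m) with prime⇒irreducible prime-p d∣p
... | inj₁ d≡1    = d≡1
... | inj₂ refl   = ⊥-elim (p∤m d∣m)

prime∤product : ∀ {p qs} → Prime p → All Prime qs → All (p ≢_) qs → ¬ p ∣ₙ product qs
prime∤product prime-p All.[] All.[] p∣1 = ¬prime[1] (subst Prime (∣1⇒≡1 p∣1) prime-p)
prime∤product prime-p (All._∷_ {x = q} prime-q primes) (p≢q All.∷ p≢qs) p∣q*qs
  with euclidsLemma q _ prime-p p∣q*qs
... | inj₂ p∣qs = prime∤product prime-p primes p≢qs p∣qs
... | inj₁ p∣q with prime⇒irreducible prime-q p∣q
...   | inj₁ p≡1 = ¬prime[1] (subst Prime p≡1 prime-p)
...   | inj₂ p≡q = p≢q p≡q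

∃-inverse-mod : ∀ {p m} → Prime p → ¬ p ∣ₙ m → ∃[ u ] (+ p ∣ u * + m - + 1)
∃-inverse-mod {p} {m} prime-p p∤m with coprime-Bézout (prime∤⇒coprime prime-p p∤m)
... | Bézout.+- x y 1+ym≡xp = - + y , divides (- + x) (begin
  - + y * + m - + 1     ≡⟨ negate-shift (+ y) (+ m) ⟩
  - (+ 1 + + y * + m)   ≡⟨ cong (λ z → - (+ 1 + z)) (pos-* y m) ⟨
  - + (1 ℕ.+ y ℕ.* m)   ≡⟨ cong (λ z → - + z) 1+ym≡xp ⟩
  - + (x ℕ.* p)         ≡⟨ cong -_ (pos-* x p) ⟩
  - (+ x * + p)         ≡⟨ neg-distribˡ-* (+ x) (+ p) ⟩
  - + x * + p           ∎)
  where
  open ≡-Reasoning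
  negate-shift : ∀ y m → - y * m - + 1 ≡ - (+ 1 + y * m)
  negate-shift = solve-∀
... | Bézout.-+ x y 1+xp≡ym = + y , divides (+ x) (begin
  + y * + m - + 1        ≡⟨ cong (_- + 1) (pos-* y m) ⟨
  + (y ℕ.* m) - + 1      ≡⟨ cong (λ z → + z - + 1) 1+xp≡ym ⟨
  + (1 ℕ.+ x ℕ.* p) - + 1 ≡⟨ cong (λ z → + 1 + z - + 1) (pos-* x p) ⟩
  + 1 + + x * + p - + 1  ≡⟨ cancel (+ x * + p) ⟩
  + x * + p              ∎)
  where
  open ≡-Reasoning
  cancel : ∀ z → + 1 + z - + 1 ≡ z
  cancel = solve-∀

∃-offset-divisible : ∀ {p m} → Prime p → ¬ p ∣ₙ m → ∀ x → ∃[ t ] t < p × (+ p ∣ x + + t * + m)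
∃-offset-divisible {p} {m} prime-p p∤m x with ∃-inverse-mod prime-p p∤m
... | u , divides c um-1≡cp = t , n%ℕd<d (- x * u) p , divides (- x * c - s * + m) (begin
  x + + t * + m                      ≡⟨ cong (λ z → x + z * + m) t≡-xu-sp ⟩
  x + (- x * u - s * + p) * + m      ≡⟨ expand x u s (+ p) (+ m) ⟩
  - x * (u * + m - + 1) - s * + m * + p ≡⟨ cong (λ z → - x * z - s * + m * + p) um-1≡cp ⟩
  - x * (c * + p) - s * + m * + p    ≡⟨ factor x c s (+ p) (+ m) ⟩
  (- x * c - s * + m) * + p          ∎)
  where
  open ≡-Reasoning
  instance
    p≢0 : NonZero p
    p≢0 = prime⇒nonZero prime-p
  t = (- x * u) %ℕ p
  s = (- x * u) /ℕ p
  t≡-xu-sp : + t ≡ - x * u - s * + p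
  t≡-xu-sp = trans (add-sub (+ t) (s * + p)) (cong (_- s * + p) (sym (a≡a%ℕn+[a/ℕn]*n (- x * u) p)))
    where
    add-sub : ∀ a b → a ≡ a + b - b
    add-sub = solve-∀
  expand : ∀ x u s p m → x + (- x * u - s * p) * m ≡ - x * (u * m - + 1) - s * m * p
  expand = solve-∀
  factor : ∀ x c s p m → - x * (c * p) - s * m * p ≡ (- x * c - s * m) * p
  factor = solve-∀

∣∧<⇒≡0 : ∀ {p e} → p ∣ₙ e → e < p → e ≡ 0
∣∧<⇒≡0 {e = zero}  _   _   = refl
∣∧<⇒≡0 {e = suc _} p∣e e<p = ⊥-elim (>⇒∤ e<p p∣e)

offset-divisible-unique≤ : ∀ {p m t t′} (x : ℤ) → Prime p → ¬ p ∣ₙ m → t < p → t′ ≤ t →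
  + p ∣ x + + t * + m → + p ∣ x + + t′ * + m → t ≡ t′
offset-divisible-unique≤ {p} {m} {t} {t′} x prime-p p∤m t<p t′≤t p∣x+tm p∣x+t′m =
  fromEuclid (euclidsLemma e m prime-p (∣⇒∣ᵤ p∣em))
  where
  open ≡-Reasoning
  e = t ∸ t′
  fromEuclid : p ∣ₙ e ⊎ p ∣ₙ m → t ≡ t′
  fromEuclid (inj₂ p∣m) = ⊥-elim (p∤m p∣m)
  fromEuclid (inj₁ p∣e) = begin
    t         ≡⟨ m+[n∸m]≡n t′≤t ⟨
    t′ ℕ.+ e  ≡⟨ cong (t′ ℕ.+_) (∣∧<⇒≡0 p∣e (ℕₚ.≤-<-trans (m∸n≤m t t′) t<p)) ⟩
    t′ ℕ.+ 0  ≡⟨ ℕₚ.+-identityʳ t′ ⟩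
    t′        ∎
  difference : ∀ x a b m → (x + (a + b) * m) - (x + a * m) ≡ b * m
  difference = solve-∀
  p∣em : + p ∣ + (e ℕ.* m)
  p∣em = subst (+ p ∣_)
    (trans (cong (λ z → (x + + z * + m) - (x + + t′ * + m)) (sym (m+[n∸m]≡n t′≤t)))
           (trans (difference x (+ t′) (+ e) (+ m)) (sym (pos-* e m))))
    (∣m∣n⇒∣m-n p∣x+tm p∣x+t′m)

offset-divisible-unique : ∀ {p m t t′} (x : ℤ) → Prime p → ¬ p ∣ₙ m → t < p → t′ < p →
  + p ∣ x + + t * + m → + p ∣ x + + t′ * + m → t ≡ t′
offset-divisible-unique {t = t} {t′} x prime-p p∤m t<p t′<p p∣x+tm p∣x+t′m with ℕₚ.≤-total t′ t
... | inj₁ t′≤t = offset-divisible-unique≤ x prime-p p∤m t<p t′≤t p∣x+tm p∣x+t′m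
... | inj₂ t≤t′ = sym (offset-divisible-unique≤ x prime-p p∤m t′<p t≤t′ p∣x+t′m p∣x+tm)

-- Counting

∑< : ℕ → (ℕ → ℤ) → ℤ
∑< n f = sum {n} (f ∘ toℕ)

∑<-cong : ∀ n {f g : ℕ → ℤ} → (∀ i → i < n → f i ≡ g i) → ∑< n f ≡ ∑< n g
∑<-cong n f≗g = sum-cong-≗ (λ i → f≗g (toℕ i) (toℕ<n i))

∑<-const : ∀ n c → ∑< n (λ _ → c) ≡ + n * c
∑<-const zero    c = refl
∑<-const (suc n) c = trans (cong (_+_ c) (∑<-const n c)) (suc-* (+ n) c)
  where
  suc-* : ∀ n c → c + n * c ≡ (+ 1 + n) * c
  suc-* = solve-∀

∑<-+ : ∀ m n f → ∑< (m ℕ.+ n) f ≡ ∑< m f + ∑< n (λ i → f (m ℕ.+ i))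
∑<-+ zero    n f = sym (+-identityˡ (∑< n f))
∑<-+ (suc m) n f = trans (cong (_+_ (f 0)) (∑<-+ m n (f ∘ suc))) (sym (+-assoc (f 0) _ _))

∑<-* : ∀ a b f → ∑< (a ℕ.* b) f ≡ ∑< a (λ t → ∑< b (λ m → f (t ℕ.* b ℕ.+ m)))
∑<-* zero    b f = refl
∑<-* (suc a) b f = trans (∑<-+ b (a ℕ.* b) f) (cong (_+_ (∑< b f)) (trans (∑<-* a b (λ i → f (b ℕ.+ i)))
  (∑<-cong a λ t _ → ∑<-cong b λ m _ → cong f (sym (ℕₚ.+-assoc b (t ℕ.* b) m)))))

∑<-comm : ∀ a b (f : ℕ → ℕ → ℤ) → ∑< a (λ t → ∑< b (f t)) ≡ ∑< b (λ n → ∑< a (λ t → f t n))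
∑<-comm a b f = ∑-comm {a} {b} (λ i j → f (toℕ i) (toℕ j))

𝟙 : ∀ {p} {P : Set p} → Dec P → ℕ
𝟙 P? = if does P? then 1 else 0

∑<-𝟙-unique : ∀ {p} {P : ℕ → Set p} (P? : ∀ t → Dec (P t)) (u : ℕ → ℤ) {n t₀} → t₀ < n → P t₀ →
  (∀ t → t < n → P t → t ≡ t₀) → ∑< n (λ t → u (𝟙 (P? t))) ≡ u 1 + (+ n - + 1) * u 0
∑<-𝟙-unique P? u {suc n} {zero} _ P0 unique = begin
  u (𝟙 (P? 0)) + ∑< n (λ t → u (𝟙 (P? (suc t))))
    ≡⟨ cong₂ _+_ (cong (λ b → u (if b then 1 else 0)) (dec-true (P? 0) P0))
                 (∑<-cong n λ t t<n → cong (λ b → u (if b then 1 else 0))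
                    (dec-false (P? (suc t)) (ℕₚ.1+n≢0 ∘ unique (suc t) (s≤s t<n)))) ⟩
  u 1 + ∑< n (λ _ → u 0)
    ≡⟨ cong (_+_ (u 1)) (∑<-const n (u 0)) ⟩
  u 1 + + n * u 0
    ≡⟨ shift (u 1) (u 0) (+ n) ⟩
  u 1 + (+ suc n - + 1) * u 0 ∎
  where
  open ≡-Reasoning
  shift : ∀ a b n → a + n * b ≡ a + ((+ 1 + n) - + 1) * b
  shift = solve-∀
∑<-𝟙-unique P? u {suc n} {suc t₀} (s≤s t₀<n) Pt₀ unique = begin
  u (𝟙 (P? 0)) + ∑< n (λ t → u (𝟙 (P? (suc t))))
    ≡⟨ cong₂ _+_ (cong (λ b → u (if b then 1 else 0)) (dec-false (P? 0) (ℕₚ.0≢1+n ∘ unique 0 z<s)))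
                 (∑<-𝟙-unique (P? ∘ suc) u t₀<n Pt₀
                    (λ t t<n P1+t → ℕₚ.suc-injective (unique (suc t) (s≤s t<n) P1+t))) ⟩
  u 0 + (u 1 + (+ n - + 1) * u 0)
    ≡⟨ shift (u 1) (u 0) (+ n) ⟩
  u 1 + (+ suc n - + 1) * u 0 ∎
  where
  open ≡-Reasoning
  shift : ∀ a b n → b + (a + (n - + 1) * b) ≡ a + ((+ 1 + n) - + 1) * b
  shift = solve-∀

∑<-𝟙-offset-divisible : ∀ {p m} → Prime p → ¬ p ∣ₙ m → ∀ x (u : ℕ → ℤ) →
  ∑< p (λ t → u (𝟙 (+ p ∣? x + + t * + m))) ≡ u 1 + (+ p - + 1) * u 0
∑<-𝟙-offset-divisible {p} {m} prime-p p∤m x u = fromSolution (∃-offset-divisible prime-p p∤m x)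
  where
  fromSolution : ∃[ t₀ ] t₀ < p × (+ p ∣ x + + t₀ * + m) →
                 ∑< p (λ t → u (𝟙 (+ p ∣? x + + t * + m))) ≡ u 1 + (+ p - + 1) * u 0
  fromSolution (t₀ , t₀<p , p∣x+t₀m) = ∑<-𝟙-unique (λ t → + p ∣? x + + t * + m) u t₀<p p∣x+t₀m
    (λ t t<p p∣x+tm → offset-divisible-unique x prime-p p∤m t<p t₀<p p∣x+tm p∣x+t₀m)

module _ {a p} {A : Set a} {P : A → Set p} (P? : ∀ x → Dec (P x)) where

  length-filter-∷ : ∀ x xs → length (filter P? (x L.∷ xs)) ≡ 𝟙 (P? x) ℕ.+ length (filter P? xs)
  length-filter-∷ x xs with does (P? x)
  ... | true  = refl
  ... | false = refl

  length-filter-applyUpTo : ∀ (f : ℕ → A) n →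
    + length (filter P? (applyUpTo f n)) ≡ ∑< n (λ i → + 𝟙 (P? (f i)))
  length-filter-applyUpTo f zero    = refl
  length-filter-applyUpTo f (suc n) =
    trans (cong +_ (length-filter-∷ (f 0) (applyUpTo (f ∘ suc) n)))
          (cong (_+_ (+ 𝟙 (P? (f 0)))) (length-filter-applyUpTo (f ∘ suc) n))

length-filter-tabulate : ∀ {a p} {A : Set a} {P : A → Set p} (P? : ∀ x → Dec (P x)) {n} (f : Fin n → A) →
  length (filter P? (tabulate f)) ≡ length (filter (P? ∘ f) (allFin n))
length-filter-tabulate P? {zero}  f = refl
length-filter-tabulate P? {suc n} f = begin
  length (filter P? (tabulate f))
    ≡⟨ length-filter-∷ P? (f zero) (tabulate (f ∘ suc)) ⟩
  𝟙 (P? (f zero)) ℕ.+ length (filter P? (tabulate (f ∘ suc)))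
    ≡⟨ cong (𝟙 (P? (f zero)) ℕ.+_) (trans (length-filter-tabulate P? (f ∘ suc))
                                         (sym (length-filter-tabulate (P? ∘ f) suc))) ⟩
  𝟙 (P? (f zero)) ℕ.+ length (filter (P? ∘ f) (tabulate suc))
    ≡⟨ length-filter-∷ (P? ∘ f) zero (tabulate suc) ⟨
  length (filter (P? ∘ f) (allFin (suc n))) ∎
  where open ≡-Reasoning

γ-suc : ∀ {k} (q : Fin (suc k) → ℕ) (r : Fin (suc k) → ℤ) n →
  γ q r n ≡ 𝟙 (+ q zero ∣? + n - r zero) ℕ.+ γ (q ∘ suc) (r ∘ suc) n
γ-suc q r n = trans (length-filter-∷ P? zero (tabulate suc)) (cong (𝟙 (P? zero) ℕ.+_) (length-filter-tabulate P? suc))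
  where
  P? = λ i → + q i ∣? + n - r i

+1+t*m+n-r : ∀ t m n r → + suc (t ℕ.* m ℕ.+ n) - r ≡ (+ suc n - r) + + t * + m
+1+t*m+n-r t m n r = trans (cong (λ z → + 1 + (z + + n) - r) (pos-* t m)) (regroup (+ t * + m) (+ n) r)
  where
  regroup : ∀ a n r → + 1 + (a + n) - r ≡ (+ 1 + n - r) + a
  regroup = solve-∀

γ-periodic : ∀ {k} (q : Fin k → ℕ) r {m} → (∀ i → q i ∣ₙ m) →
  ∀ t n → γ q r (suc (t ℕ.* m ℕ.+ n)) ≡ γ q r (suc n)
γ-periodic {k} q r {m} q∣m t n = cong length (filter-≐ (P? (suc (t ℕ.* m ℕ.+ n))) (P? (suc n)) (⇒ , ⇐) (allFin k))
  where
  P? = λ n i → + q i ∣? + n - r i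
  q∣tm : ∀ i → + q i ∣ + t * + m
  q∣tm i = ∣n⇒∣m*n (+ t) (∣ᵤ⇒∣ (q∣m i))
  ⇒ : ∀ {i} → + q i ∣ + suc (t ℕ.* m ℕ.+ n) - r i → + q i ∣ + suc n - r i
  ⇒ {i} d = ∣m+n∣n⇒∣m (subst (+ q i ∣_) (+1+t*m+n-r t m n (r i)) d) (q∣tm i)
  ⇐ : ∀ {i} → + q i ∣ + suc n - r i → + q i ∣ + suc (t ℕ.* m ℕ.+ n) - r i
  ⇐ {i} d = subst (+ q i ∣_) (sym (+1+t*m+n-r t m n (r i))) (∣m∣n⇒∣m+n d (q∣tm i))

prodQ-suc : ∀ {k} (q : Fin (suc k) → ℕ) → prodQ q ≡ q zero ℕ.* prodQ (q ∘ suc)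
prodQ-suc q = cong (λ qs → q zero ℕ.* product qs) (trans (map-tabulate suc q) (sym (map-tabulate id (q ∘ suc))))

weightedCount : ∀ {k} → (Fin k → ℕ) → (Fin k → ℤ) → (ℕ → ℤ) → ℤ
weightedCount q r w = ∑< (prodQ q) (λ i → w (γ q r (suc i)))

weightedCount-suc : ∀ {k} (q : Fin (suc k) → ℕ) (r : Fin (suc k) → ℤ) (w : ℕ → ℤ) →
  Prime (q zero) → ¬ q zero ∣ₙ prodQ (q ∘ suc) → (∀ i → q (suc i) ∣ₙ prodQ (q ∘ suc)) →
  weightedCount q r w ≡ weightedCount (q ∘ suc) (r ∘ suc) (λ g → w (suc g) + (+ q zero - + 1) * w g)
weightedCount-suc {k} q r w prime-p p∤m q′∣m = begin
  ∑< (prodQ q) (λ i → w (γ q r (suc i)))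
    ≡⟨ cong (λ P → ∑< P (λ i → w (γ q r (suc i)))) (prodQ-suc q) ⟩
  ∑< (p ℕ.* m) (λ i → w (γ q r (suc i)))
    ≡⟨ ∑<-* p m (λ i → w (γ q r (suc i))) ⟩
  ∑< p (λ t → ∑< m (λ n → w (γ q r (suc (t ℕ.* m ℕ.+ n)))))
    ≡⟨ ∑<-comm p m (λ t n → w (γ q r (suc (t ℕ.* m ℕ.+ n)))) ⟩
  ∑< m (λ n → ∑< p (λ t → w (γ q r (suc (t ℕ.* m ℕ.+ n)))))
    ≡⟨ ∑<-cong m (λ n _ → fibre n) ⟩
  ∑< m (λ n → w (suc (γ′ (suc n))) + (+ p - + 1) * w (γ′ (suc n))) ∎
  where
  open ≡-Reasoning
  p : ℕ
  p = q zero
  m : ℕ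
  m = prodQ (q ∘ suc)
  γ′ : ℕ → ℕ
  γ′ = γ (q ∘ suc) (r ∘ suc)
  fibre : ∀ n → ∑< p (λ t → w (γ q r (suc (t ℕ.* m ℕ.+ n))))
                ≡ w (suc (γ′ (suc n))) + (+ p - + 1) * w (γ′ (suc n))
  fibre n = trans (∑<-cong p λ t _ → cong w (trans (γ-suc q r (suc (t ℕ.* m ℕ.+ n)))
                     (cong₂ ℕ._+_ (cong (λ z → 𝟙 (+ p ∣? z)) (+1+t*m+n-r t m n (r zero)))
                                  (γ-periodic (q ∘ suc) (r ∘ suc) q′∣m t n))))
                  (∑<-𝟙-offset-divisible prime-p p∤m (+ suc n - r zero) (λ b → w (b ℕ.+ γ′ (suc n))))

weight₀₁ : ℤ → ℤ → ℕ → ℤ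
weight₀₁ a b 0             = a
weight₀₁ a b 1             = b
weight₀₁ a b (suc (suc _)) = + 0

weight₀₁-suc : ∀ a b d g → weight₀₁ a b (suc g) + d * weight₀₁ a b g ≡ weight₀₁ (b + d * a) (d * b) g
weight₀₁-suc a b d 0             = refl
weight₀₁-suc a b d 1             = +-identityˡ (d * b)
weight₀₁-suc a b d (suc (suc g)) = trans (+-identityˡ (d * + 0)) (*-zeroʳ d)

weightedCount-weight₀₁ : ∀ {k} (q : Fin k → ℕ) (r : Fin k → ℤ) → (∀ i → Prime (q i)) → Injective _≡_ _≡_ q →
  ∀ a b → weightedCount q r (weight₀₁ a b) ≡ a * ∏ (pred q) + b * eₙ₋₁ (pred q)
weightedCount-weight₀₁ {zero}  q r _ _ a b = base a b
  where
  base : ∀ a b → a + + 0 ≡ a * + 1 + b * + 0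
  base = solve-∀
weightedCount-weight₀₁ {suc k} q r primes q-injective a b = begin
  weightedCount q r (weight₀₁ a b)
    ≡⟨ weightedCount-suc q r (weight₀₁ a b) (primes zero) q₀∤m q′∣m ⟩
  weightedCount q′ r′ (λ g → weight₀₁ a b (suc g) + d₀ * weight₀₁ a b g)
    ≡⟨ ∑<-cong (prodQ q′) (λ i _ → weight₀₁-suc a b d₀ (γ q′ r′ (suc i))) ⟩
  weightedCount q′ r′ (weight₀₁ (b + d₀ * a) (d₀ * b))
    ≡⟨ weightedCount-weight₀₁ q′ r′ (primes ∘ suc) (suc-injective ∘ q-injective) (b + d₀ * a) (d₀ * b) ⟩
  (b + d₀ * a) * ∏ (pred q′) + (d₀ * b) * eₙ₋₁ (pred q′)
    ≡⟨ regroup a b d₀ (∏ (pred q′)) (eₙ₋₁ (pred q′)) ⟩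
  a * ∏ (pred q) + b * eₙ₋₁ (pred q) ∎
  where
  open ≡-Reasoning
  q′ = q ∘ suc
  r′ = r ∘ suc
  d₀ = pred q zero
  q₀∤m : ¬ q zero ∣ₙ prodQ q′
  q₀∤m = prime∤product (primes zero) (All.map⁺ (All.tabulate⁺ (primes ∘ suc)))
                       (All.map⁺ (All.tabulate⁺ (λ i → 0≢1+n ∘ q-injective)))
  q′∣m : ∀ i → q′ i ∣ₙ prodQ q′
  q′∣m i = ∈⇒∣product (∈-map⁺ q′ (∈-allFin i))
  regroup : ∀ a b d P e → (b + d * a) * P + (d * b) * e ≡ a * (d * P) + b * (P + d * e)
  regroup = solve-∀

length-filter-γ : ∀ {k} (q : Fin k → ℕ) (r : Fin k → ℤ) → (∀ i → Prime (q i)) → Injective _≡_ _≡_ q →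
  ∀ {ℓ} {P : ℕ → Set ℓ} (P? : ∀ g → Dec (P g)) a b → (∀ g → + 𝟙 (P? g) ≡ weight₀₁ a b g) →
  + length (filter (P? ∘ γ q r) (range1 (prodQ q))) ≡ a * ∏ (pred q) + b * eₙ₋₁ (pred q)
length-filter-γ q r primes q-injective P? a b 𝟙≡weight = begin
  + length (filter (P? ∘ γ q r) (L.map suc (L.upTo (prodQ q))))
    ≡⟨ cong (λ ns → + length (filter (P? ∘ γ q r) ns)) (map-applyUpTo id suc (prodQ q)) ⟩
  + length (filter (P? ∘ γ q r) (applyUpTo suc (prodQ q)))
    ≡⟨ length-filter-applyUpTo (P? ∘ γ q r) suc (prodQ q) ⟩
  ∑< (prodQ q) (λ i → + 𝟙 (P? (γ q r (suc i))))
    ≡⟨ ∑<-cong (prodQ q) (λ i _ → 𝟙≡weight (γ q r (suc i))) ⟩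
  weightedCount q r (weight₀₁ a b)
    ≡⟨ weightedCount-weight₀₁ q r primes q-injective a b ⟩
  a * ∏ (pred q) + b * eₙ₋₁ (pred q) ∎
  where open ≡-Reasoning

𝟙-≤1 : ∀ g → + 𝟙 (g ≤? 1) ≡ weight₀₁ (+ 1) (+ 1) g
𝟙-≤1 0             = refl
𝟙-≤1 1             = refl
𝟙-≤1 (suc (suc _)) = refl

𝟙-≡0 : ∀ g → + 𝟙 (g ≟ 0) ≡ weight₀₁ (+ 1) (+ 0) g
𝟙-≡0 0             = refl
𝟙-≡0 1             = refl
𝟙-≡0 (suc (suc _)) = refl

theorem2 : (k : ℕ) → 2 ≤ k → (q : Fin k → ℕ) → (∀ i → Prime (q i)) → Injective _≡_ _≡_ q →
    (r : Fin k → ℤ) →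
    (+ length (filter (λ n → γ q r n ≤? 1) (range1 (prodQ q))) ≡ A k q)
    × (+ length (filter (λ n → γ q r n ≟ 0) (range1 (prodQ q))) ≡ F k q)
theorem2 k _ q primes q-injective r = atMostOne , none
  where
  open ≡-Reasoning
  atMostOne : + length (filter (λ n → γ q r n ≤? 1) (range1 (prodQ q))) ≡ A k q
  atMostOne = begin
    + length (filter (λ n → γ q r n ≤? 1) (range1 (prodQ q)))
      ≡⟨ length-filter-γ q r primes q-injective (_≤? 1) (+ 1) (+ 1) 𝟙-≤1 ⟩
    + 1 * ∏ (pred q) + + 1 * eₙ₋₁ (pred q)
      ≡⟨ cong₂ _+_ (*-identityˡ (∏ (pred q))) (*-identityˡ (eₙ₋₁ (pred q))) ⟩
    ∏ (pred q) + eₙ₋₁ (pred q)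
      ≡⟨ A≡∏+eₙ₋₁ q ⟨
    A k q ∎
  none : + length (filter (λ n → γ q r n ≟ 0) (range1 (prodQ q))) ≡ F k q
  none = begin
    + length (filter (λ n → γ q r n ≟ 0) (range1 (prodQ q)))
      ≡⟨ length-filter-γ q r primes q-injective (_≟ 0) (+ 1) (+ 0) 𝟙-≡0 ⟩
    + 1 * ∏ (pred q) + + 0 * eₙ₋₁ (pred q)
      ≡⟨ trans (+-identityʳ (+ 1 * ∏ (pred q))) (*-identityˡ (∏ (pred q))) ⟩
    ∏ (pred q)
      ≡⟨ F≡∏ k q ⟨
    F k q ∎
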